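{- Let $P$ be a finite poset on a ground set $V$ and let $S\subseteq V$. Put $U=U[S]\setminus S$ and $D=D[S]\setminus S$. Then \[ \dim P\le 2\big(\dim P[D[S]\cup U[S]]+\dim P[V\setminus S]\big) \] and \[ \dim P[D[S]\cup U[S]]\le \dim P[D[S]]+\dim P[U[S]]+\dim P[D\cup U]. \]
   Context: For $S\subseteq V$, $U[S]=\{x: y\le_P x\text{ for some }y\in S\}$ and $D[S]=\{x: x\le_P y\text{ for some }y\in S\}$. $P[X]$ denotes the subposet induced on $X$. The dimension $\dim P$ is the minimum number of linear orders on the ground set whose intersection is the order of $P$. -}

module Defs where

open import Level using (0ℓ)
open import Data.Nat using (ℕ; _≤_; _<_; _+_; _*_)
open import Data.Fin using (Fin)
open import Data.Product using (Σ; ∃; _×_; _,_)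
open import Data.Sum using (_⊎_)
open import Relation.Binary using (Rel; IsPartialOrder)
open import Relation.Binary.PropositionalEquality using (_≡_)
open import Relation.Unary using (Pred; _∈_; _∪_; _∩_; ∁; U)

record FinPoset (n : ℕ) : Set₁ where
  field
    _≼_       : Rel (Fin n) 0ℓ
    isPartialOrder : IsPartialOrder _≡_ _≼_

Subset : ℕ → Set₁
Subset n = Pred (Fin n) 0ℓ

module _ {n : ℕ} (P : FinPoset n) where
  open FinPoset P

  Up : Subset n → Subset n
  Up S x = Σ (Fin n) λ y → y ∈ S × y ≼ x

  Down : Subset n → Subset n
  Down S x = Σ (Fin n) λ y → y ∈ S × x ≼ y

  _∖_ : Subset n → Subset n → Subset n
  X ∖ Y = X ∩ ∁ Y

  record IsLinearOn (X : Subset n) (L : Rel (Fin n) 0ℓ) : Set where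
    field
      reflOn    : ∀ {x} → x ∈ X → L x x
      antisymOn : ∀ {x y} → x ∈ X → y ∈ X → L x y → L y x → x ≡ y
      transOn   : ∀ {x y z} → x ∈ X → y ∈ X → z ∈ X → L x y → L y z → L x z
      totalOn   : ∀ {x y} → x ∈ X → y ∈ X → L x y ⊎ L y x

  -- a realizer of P[X] of size t: t linear orders on X whose
  -- intersection is the order of P restricted to X.
  -- Convention: a nonempty poset needs at least one linear order.
  record Realizer (X : Subset n) (t : ℕ) : Set₁ where
    field
      L        : Fin t → Rel (Fin n) 0ℓ
      linear   : ∀ i → IsLinearOn X (L i)
      sound    : ∀ {x y} → x ∈ X → y ∈ X → x ≼ y → ∀ i → L i x y
      complete : ∀ {x y} → x ∈ X → y ∈ X → (∀ i → L i x y) → x ≼ y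
      nonempty : (Σ (Fin n) λ x → x ∈ X) → 1 ≤ t

  IsDim : Subset n → ℕ → Set₁
  IsDim X d = Realizer X d × (∀ t → Realizer X t → d ≤ t)

-- Realizers are assembled from ranks. A family of ranks r_i : V → ℕ, each monotone on X, such that
-- every pair x ⋠ y in X has some r_i y < r_i x, yields a realizer of P[X] once ties are broken by
-- one fixed linear extension. Let D be a down-set and U′ an up-set of P. Every linear order of
-- P[X ∩ D] gives a rank listing X ∩ D first, in that order; every order of P[X ∩ U′] one listing
-- X ∩ U′ last; and every order L of P[W], W = X ∖ (D ∩ U′), extends to the rank of x given by the
-- largest L-position of an element of W below x. A pair x ⋠ y is reversed by the first family if
-- y ∈ D, by the second if x ∈ U′, and otherwise x, y ∈ W and the third family reverses it. Hence
-- dim P[X] ≤ dim P[X ∩ D] + dim P[X ∩ U′] + dim P[X ∖ (D ∩ U′)]; taking D = D[S], U′ = U[S] and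
-- X = V or X = D[S] ∪ U[S] (and restricting realizers to subsets) gives both inequalities.
-- The construction needs ≼, S and the realizers' orders to be decidable. Over a finite ground set
-- that holds up to double negation, which suffices because the conclusion is a decidable inequality.

module Submission where

open import Defs
open import Data.Nat using (ℕ; _≤_; _+_; _*_)
open import Data.Product using (_×_)
open import Relation.Unary using (U; ∁; _∪_)

open import Level using (0ℓ)
open import Data.Bool.Properties using (T-≡)
open import Data.Empty using (⊥-elim)
open import Data.Fin as F using (Fin; _↑ˡ_; _↑ʳ_; fromℕ<)
open import Data.Fin.Properties using (any?; ¬∀⟶∃¬)
import Data.Fin.Subset as Sub
import Data.Fin.Subset.Properties as Subₚ
open import Data.List using (map; filter; allFin)
open import Data.List.Extrema.Nat using (max; max≤v⁺; xs≤max; max-mono-⊆)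
open import Data.List.Membership.Propositional.Properties
  using (∈-allFin; ∈-filter⁺; ∈-filter⁻; ∈-map⁺)
open import Data.List.Relation.Binary.Subset.Propositional using () renaming (_⊆_ to _⊆ₗ_)
import Data.List.Relation.Binary.Subset.Propositional.Properties as ListSubset
import Data.List.Relation.Unary.All as All
import Data.List.Relation.Unary.All.Properties as Allₚ
open import Data.Nat using (zero; suc; _<_; _≤?_; z≤n; s≤s; _%_)
open import Data.Nat.DivMod using ([m+kn]%n≡m%n; m<n⇒m%n≡m)
open import Data.Nat.Properties
open import Data.Nat.Solver using (module +-*-Solver)
open import Data.Product using (_,_; proj₁; proj₂)
open import Data.Sum using (inj₁; inj₂; fromInj₁)
open import Data.Unit using (tt)
open import Data.Vec using (tabulate)
open import Data.Vec.Properties using (lookup∘tabulate; lookup⇒[]=; []=⇒lookup)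
open import Data.Vec.Functional using (Vector; _++_)
open import Data.Vec.Functional.Properties using (lookup-++ˡ; lookup-++ʳ)
open import Data.Vec.Functional.Relation.Unary.All using () renaming (All to AllOf)
open import Data.Vec.Functional.Relation.Unary.All.Properties using (++⁺)
open import Data.Vec.Functional.Relation.Unary.Any using (Any)
open import Effect.Monad using (RawMonad)
open import Function using (_∘_; Equivalence)
open import Relation.Binary using (Rel; IsPartialOrder)
import Relation.Binary.Definitions as B
open import Relation.Binary.PropositionalEquality
  using (_≡_; refl; sym; trans; cong; subst; subst₂; module ≡-Reasoning)
open import Relation.Nullary using (¬_; yes; no; isYes; contradiction)
open import Relation.Nullary.Decidable
  using (_×-dec_; fromWitness; toWitness; decidable-stable; ¬¬-excluded-middle)
open import Relation.Nullary.Negation using (¬¬-Monad)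
open import Relation.Unary using (Pred; Decidable; Satisfiable; _∈_; _∉_; _⊆_; _∩_)
open import Relation.Unary.Properties using (U?; ∁?; _∩?_; _∪?_)

open RawMonad (¬¬-Monad {0ℓ}) using (_>>=_; pure)

m+k*n<m′+k′*n : ∀ {m m′ k k′ n} → m < n → k < k′ → m + k * n < m′ + k′ * n
m+k*n<m′+k′*n {m} {m′} {k} {k′} {n} m<n k<k′ = begin-strict
  m + k * n    <⟨ +-monoˡ-< (k * n) m<n ⟩
  suc k * n    ≤⟨ *-monoˡ-≤ n k<k′ ⟩
  k′ * n       ≤⟨ m≤n+m (k′ * n) m′ ⟩
  m′ + k′ * n  ∎
  where open ≤-Reasoning

m+k*n≡m′+k′*n⇒m≡m′ : ∀ {m m′ k k′ n} → m < n → m′ < n → m + k * n ≡ m′ + k′ * n → m ≡ m′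
m+k*n≡m′+k′*n⇒m≡m′ {m} {m′} {k} {k′} {n@(suc _)} m<n m′<n eq = begin
  m                  ≡⟨ m<n⇒m%n≡m m<n ⟨
  m % n              ≡⟨ [m+kn]%n≡m%n m k n ⟨
  (m + k * n) % n    ≡⟨ cong (_% n) eq ⟩
  (m′ + k′ * n) % n  ≡⟨ [m+kn]%n≡m%n m′ k′ n ⟩
  m′ % n             ≡⟨ m<n⇒m%n≡m m′<n ⟩
  m′                 ∎
  where open ≡-Reasoning

m+m+n≤2*[m+n] : ∀ m n → m + m + n ≤ 2 * (m + n)
m+m+n≤2*[m+n] m n = begin
  m + m + n      ≤⟨ m≤m+n (m + m + n) n ⟩
  m + m + n + n  ≡⟨ solve 2 (λ m n → m :+ m :+ n :+ n := con 2 :* (m :+ n)) refl m n ⟩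
  2 * (m + n)    ∎
  where
  open ≤-Reasoning
  open +-*-Solver

module _ {A : Set} (P : Pred A 0ℓ) {k l : ℕ} {xs : Vector A k} {ys : Vector A l} where

  any-++⁺ˡ : Any P xs → Any P (xs ++ ys)
  any-++⁺ˡ (i , p) = i ↑ˡ l , subst P (sym (lookup-++ˡ xs ys i)) p

  any-++⁺ʳ : Any P ys → Any P (xs ++ ys)
  any-++⁺ʳ (i , p) = k ↑ʳ i , subst P (sym (lookup-++ʳ xs ys i)) p

¬¬-∀-Fin : ∀ {m} {Q : Fin m → Set} → (∀ i → ¬ ¬ Q i) → ¬ ¬ (∀ i → Q i)
¬¬-∀-Fin {zero}  _  = pure λ ()
¬¬-∀-Fin {suc m} ¬¬Q = do
  q₀ ← ¬¬Q F.zero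
  qₛ ← ¬¬-∀-Fin (¬¬Q ∘ F.suc)
  pure λ { F.zero → q₀ ; (F.suc i) → qₛ i }

¬¬-decidable : ∀ {m} (Q : Pred (Fin m) 0ℓ) → ¬ ¬ Decidable Q
¬¬-decidable Q = ¬¬-∀-Fin λ _ → ¬¬-excluded-middle

¬¬-decidable₂ : ∀ {m} (R : Rel (Fin m) 0ℓ) → ¬ ¬ B.Decidable R
¬¬-decidable₂ R = ¬¬-∀-Fin (¬¬-decidable ∘ R)

¬¬-decidableRealizer : ∀ {n} {P : FinPoset n} {X t} (R : Realizer P X t) →
                       ¬ ¬ (∀ i → B.Decidable (Realizer.L R i))
¬¬-decidableRealizer R = ¬¬-∀-Fin (¬¬-decidable₂ ∘ Realizer.L R)

module _ {m : ℕ} {Q : Pred (Fin m) 0ℓ} where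

  subsetOf : Decidable Q → Sub.Subset m
  subsetOf Q? = tabulate (isYes ∘ Q?)

  ∈-subsetOf⁺ : (Q? : Decidable Q) → ∀ {x} → x ∈ Q → x Sub.∈ subsetOf Q?
  ∈-subsetOf⁺ Q? {x} x∈Q =
    lookup⇒[]= x _ (trans (lookup∘tabulate _ x) (Equivalence.to T-≡ (fromWitness x∈Q)))

  ∈-subsetOf⁻ : (Q? : Decidable Q) → ∀ {x} → x Sub.∈ subsetOf Q? → x ∈ Q
  ∈-subsetOf⁻ Q? {x} x∈ =
    toWitness {a? = Q? x} (Equivalence.from T-≡ (trans (sym (lookup∘tabulate _ x)) ([]=⇒lookup x∈)))

  count : Decidable Q → ℕ
  count Q? = Sub.∣ subsetOf Q? ∣

  count≤n : (Q? : Decidable Q) → count Q? ≤ m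
  count≤n Q? = Subₚ.∣p∣≤n (subsetOf Q?)

module _ {m : ℕ} {Q Q′ : Pred (Fin m) 0ℓ} (Q? : Decidable Q) (Q′? : Decidable Q′) (Q⊆Q′ : Q ⊆ Q′) where

  subsetOf-mono : subsetOf Q? Sub.⊆ subsetOf Q′?
  subsetOf-mono = ∈-subsetOf⁺ Q′? ∘ Q⊆Q′ ∘ ∈-subsetOf⁻ Q?

  count-mono : count Q? ≤ count Q′?
  count-mono = Subₚ.p⊆q⇒∣p∣≤∣q∣ subsetOf-mono

  count-< : ∀ {x} → x ∈ Q′ → x ∉ Q → count Q? < count Q′?
  count-< {x} x∈Q′ x∉Q =
    Subₚ.p⊂q⇒∣p∣<∣q∣ (subsetOf-mono , x , ∈-subsetOf⁺ Q′? x∈Q′ , x∉Q ∘ ∈-subsetOf⁻ Q?)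

module _ {n : ℕ} (P : FinPoset n) where
  open FinPoset P
  open IsPartialOrder isPartialOrder using () renaming (refl to ≼-refl; trans to ≼-trans)
  open IsLinearOn

  record DecRealizer (X : Subset n) (t : ℕ) : Set₁ where
    constructor _with-decidable_
    field
      realizer : Realizer P X t
      L?       : ∀ i → B.Decidable (Realizer.L realizer i)
    open Realizer realizer public

  restrict : ∀ {X X′ t} → X′ ⊆ X → DecRealizer X t → DecRealizer X′ t
  restrict X′⊆X R = record
    { realizer = record
      { L        = L
      ; linear   = λ i → record
        { reflOn    = reflOn (linear i) ∘ X′⊆X
        ; antisymOn = λ x∈ y∈ → antisymOn (linear i) (X′⊆X x∈) (X′⊆X y∈)
        ; transOn   = λ x∈ y∈ z∈ → transOn (linear i) (X′⊆X x∈) (X′⊆X y∈) (X′⊆X z∈)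
        ; totalOn   = λ x∈ y∈ → totalOn (linear i) (X′⊆X x∈) (X′⊆X y∈)
        }
      ; sound    = λ x∈ y∈ → sound (X′⊆X x∈) (X′⊆X y∈)
      ; complete = λ x∈ y∈ → complete (X′⊆X x∈) (X′⊆X y∈)
      ; nonempty = λ (x , x∈) → nonempty (x , X′⊆X x∈)
      }
    ; L? = L?
    }
    where open DecRealizer R

  Monotone : Subset n → (Fin n → ℕ) → Set
  Monotone X f = ∀ {x y} → x ∈ X → y ∈ X → x ≼ y → f x ≤ f y

  Inverts : Fin n → Fin n → Pred (Fin n → ℕ) 0ℓ
  Inverts x y r = r y < r x

  Reverses : Subset n → ∀ {t} → Vector (Fin n → ℕ) t → Set
  Reverses X rs = ∀ {x y} → x ∈ X → y ∈ X → ¬ x ≼ y → Any (Inverts x y) rs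

  IsDownSet IsUpSet : Subset n → Set
  IsDownSet D = ∀ {x y} → x ≼ y → y ∈ D → x ∈ D
  IsUpSet   U′ = ∀ {x y} → x ≼ y → x ∈ U′ → y ∈ U′

  Down-isDownSet : ∀ S → IsDownSet (Down P S)
  Down-isDownSet S x≼y (s , s∈S , y≼s) = s , s∈S , ≼-trans x≼y y≼s

  Up-isUpSet : ∀ S → IsUpSet (Up P S)
  Up-isUpSet S x≼y (s , s∈S , s≼x) = s , s∈S , ≼-trans s≼x x≼y

  record LinearExtension (X : Subset n) : Set where
    field
      key       : Fin n → ℕ
      monotone  : Monotone X key
      injective : ∀ {x y} → x ∈ X → y ∈ X → key x ≡ key y → x ≡ y
      bounded   : ∀ x → key x ≤ n

  module Positions {Z : Subset n} (Z? : Decidable Z) {t : ℕ} (R : DecRealizer Z t) where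
    open DecRealizer R

    Preceding : Fin t → Fin n → Subset n
    Preceding i x w = w ∈ Z × L i w x

    preceding? : ∀ i x → Decidable (Preceding i x)
    preceding? i x w = Z? w ×-dec L? i w x

    position : Fin t → Fin n → ℕ
    position i x = count (preceding? i x)

    position-≤ : ∀ i {x y} → x ∈ Z → y ∈ Z → L i x y → position i x ≤ position i y
    position-≤ i {x} {y} x∈Z y∈Z Lxy = count-mono (preceding? i x) (preceding? i y)
      λ (w∈Z , Lwx) → w∈Z , transOn (linear i) w∈Z x∈Z y∈Z Lwx Lxy

    position-< : ∀ i {x y} → x ∈ Z → y ∈ Z → ¬ L i y x → position i x < position i y
    position-< i {x} {y} x∈Z y∈Z ¬Lyx = count-< (preceding? i x) (preceding? i y)
      (λ (w∈Z , Lwx) → w∈Z , transOn (linear i) w∈Z x∈Z y∈Z Lwx Lxy)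
      (y∈Z , reflOn (linear i) y∈Z) (¬Lyx ∘ proj₂)
      where
      Lxy : L i x y
      Lxy = fromInj₁ (⊥-elim ∘ ¬Lyx) (totalOn (linear i) x∈Z y∈Z)

    position-injective : ∀ i {x y} → x ∈ Z → y ∈ Z → position i x ≡ position i y → x ≡ y
    position-injective i {x} {y} x∈Z y∈Z eq with L? i x y | L? i y x
    ... | yes Lxy | yes Lyx = antisymOn (linear i) x∈Z y∈Z Lxy Lyx
    ... | _       | no ¬Lyx = contradiction eq (<⇒≢ (position-< i x∈Z y∈Z ¬Lyx))
    ... | no ¬Lxy | _       = contradiction eq (>⇒≢ (position-< i y∈Z x∈Z ¬Lxy))

    position-monotone : ∀ i → Monotone Z (position i)
    position-monotone i x∈Z y∈Z x≼y = position-≤ i x∈Z y∈Z (sound x∈Z y∈Z x≼y i)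

    position-linearExtension : Fin t → LinearExtension Z
    position-linearExtension i = record
      { key       = position i
      ; monotone  = position-monotone i
      ; injective = position-injective i
      ; bounded   = λ x → count≤n (preceding? i x)
      }

    position-reverses : Reverses Z position
    position-reverses {x} {y} x∈Z y∈Z x⋠y =
      let i , ¬Lxy = ¬∀⟶∃¬ t (λ i → L i x y) (λ i → L? i x y) (x⋠y ∘ complete x∈Z y∈Z)
      in  i , position-< i y∈Z x∈Z ¬Lxy

  linearExtension : ∀ {X t} → Decidable X → DecRealizer X t → LinearExtension X
  linearExtension {X} {zero} _ R = record
    { key       = λ _ → 0
    ; monotone  = λ x∈X _ _ → ⊥-elim (empty x∈X)
    ; injective = λ x∈X _ _ → ⊥-elim (empty x∈X)
    ; bounded   = λ _ → z≤n
    }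
    where
    empty : ∀ {x} → x ∉ X
    empty x∈X with () ← DecRealizer.nonempty R (_ , x∈X)
  linearExtension {t = suc _} X? R = Positions.position-linearExtension X? R F.zero

  module _ (≼? : B.Decidable _≼_) where

    realizer-fromRanks : ∀ {X t} → LinearExtension X → (r : Vector (Fin n → ℕ) t) →
                         AllOf (Monotone X) r → Reverses X r → (Satisfiable X → 1 ≤ t) →
                         Realizer P X t
    realizer-fromRanks {X} {t} e r r-monotone r-reverses X≠∅⇒1≤t = record
      { L        = λ i x y → lex i x ≤ lex i y
      ; linear   = λ i → record
        { reflOn    = λ _ → ≤-refl
        ; antisymOn = λ x∈X y∈X p q → lex-injective i x∈X y∈X (≤-antisym p q)
        ; transOn   = λ _ _ _ → ≤-trans
        ; totalOn   = λ _ _ → ≤-total _ _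
        }
      ; sound    = λ x∈X y∈X x≼y i →
          +-mono-≤ (e.monotone x∈X y∈X x≼y) (*-monoˡ-≤ (suc n) (r-monotone i x∈X y∈X x≼y))
      ; complete = complete
      ; nonempty = X≠∅⇒1≤t
      }
      where
      module e = LinearExtension e

      lex : Fin t → Fin n → ℕ
      lex i x = e.key x + r i x * suc n

      lex-injective : ∀ i {x y} → x ∈ X → y ∈ X → lex i x ≡ lex i y → x ≡ y
      lex-injective i {x} {y} x∈X y∈X eq =
        e.injective x∈X y∈X
          (m+k*n≡m′+k′*n⇒m≡m′ {k = r i x} {k′ = r i y} (s≤s (e.bounded x)) (s≤s (e.bounded y)) eq)

      complete : ∀ {x y} → x ∈ X → y ∈ X → (∀ i → lex i x ≤ lex i y) → x ≼ y
      complete {x} {y} x∈X y∈X x≤y with ≼? x y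
      ... | yes x≼y = x≼y
      ... | no  x⋠y = let i , ry<rx = r-reverses x∈X y∈X x⋠y in
        contradiction (x≤y i) (<⇒≱ (m+k*n<m′+k′*n (s≤s (e.bounded y)) ry<rx))

    Below : Subset n → Fin n → Subset n
    Below A x a = a ∈ A × a ≼ x

    below? : ∀ {A} → Decidable A → ∀ x → Decidable (Below A x)
    below? A? x a = A? a ×-dec ≼? a x

    maxBelow : ∀ {A} → Decidable A → (Fin n → ℕ) → Fin n → ℕ
    maxBelow A? f x = max 0 (map f (filter (below? A? x) (allFin n)))

    maxBelow-mono : ∀ {A} (A? : Decidable A) f {x y} → x ≼ y → maxBelow A? f x ≤ maxBelow A? f y
    maxBelow-mono A? f {x} {y} x≼y = max-mono-⊆ ≤-refl (ListSubset.map⁺ f below-x⊆below-y)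
      where
      below-x⊆below-y : filter (below? A? x) (allFin n) ⊆ₗ filter (below? A? y) (allFin n)
      below-x⊆below-y a∈ =
        let a∈all , a∈A , a≼x = ∈-filter⁻ (below? A? x) {xs = allFin n} a∈
        in  ∈-filter⁺ (below? A? y) a∈all (a∈A , ≼-trans a≼x x≼y)

    maxBelow-≡ : ∀ {A} (A? : Decidable A) {f} → Monotone A f → ∀ {x} → x ∈ A → maxBelow A? f x ≡ f x
    maxBelow-≡ A? {f} f-mono {x} x∈A = ≤-antisym
      (max≤v⁺ z≤n (Allₚ.map⁺ (All.map (λ (a∈A , a≼x) → f-mono a∈A x∈A a≼x)
                                      (Allₚ.all-filter (below? A? x) (allFin n)))))
      (All.lookup (xs≤max 0 _) (∈-map⁺ f (∈-filter⁺ (below? A? x) (∈-allFin x) (x∈A , ≼-refl))))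

    module Split {D U′ : Subset n} (D? : Decidable D) (U′? : Decidable U′)
                 (D-down : IsDownSet D) (U′-up : IsUpSet U′) {X : Subset n} (X? : Decidable X) where

      module DownFirst {a} (R : DecRealizer (X ∩ D) a) where
        open Positions (X? ∩? D?) R

        rank : Vector (Fin n → ℕ) a
        rank i x with D? x
        ... | yes _ = position i x
        ... | no  _ = suc n

        rank-monotone : AllOf (Monotone X) rank
        rank-monotone i {x} {y} x∈X y∈X x≼y with D? x | D? y
        ... | yes x∈D | yes y∈D = position-monotone i (x∈X , x∈D) (y∈X , y∈D) x≼y
        ... | yes _   | no  _   = m≤n⇒m≤1+n (count≤n (preceding? i x))
        ... | no  x∉D | yes y∈D = contradiction (D-down x≼y y∈D) x∉D
        ... | no  _   | no  _   = ≤-refl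

        rank-reverse : ∀ {x y} → x ∈ X → y ∈ X → ¬ x ≼ y → y ∈ D → Any (Inverts x y) rank
        rank-reverse {x} {y} x∈X y∈X x⋠y y∈D with D? x | D? y
        ... | _       | no  y∉D = contradiction y∈D y∉D
        ... | yes x∈D | yes _   = position-reverses (x∈X , x∈D) (y∈X , y∈D) x⋠y
        ... | no  _   | yes _   = let i = fromℕ< (DecRealizer.nonempty R (y , y∈X , y∈D)) in
          i , s≤s (count≤n (preceding? i y))

      module UpLast {b} (R : DecRealizer (X ∩ U′) b) where
        open Positions (X? ∩? U′?) R

        rank : Vector (Fin n → ℕ) b
        rank i x with U′? x
        ... | yes _ = suc (position i x)
        ... | no  _ = 0

        rank-monotone : AllOf (Monotone X) rank
        rank-monotone i {x} {y} x∈X y∈X x≼y with U′? x | U′? y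
        ... | yes x∈U′ | yes y∈U′ = s≤s (position-monotone i (x∈X , x∈U′) (y∈X , y∈U′) x≼y)
        ... | yes x∈U′ | no  y∉U′ = contradiction (U′-up x≼y x∈U′) y∉U′
        ... | no  _    | _        = z≤n

        rank-reverse : ∀ {x y} → x ∈ X → y ∈ X → ¬ x ≼ y → x ∈ U′ → Any (Inverts x y) rank
        rank-reverse {x} {y} x∈X y∈X x⋠y x∈U′ with U′? x | U′? y
        ... | no  x∉U′ | _        = contradiction x∈U′ x∉U′
        ... | yes _    | yes y∈U′ = let i , lt = position-reverses (x∈X , x∈U′) (y∈X , y∈U′) x⋠y in
          i , s≤s lt
        ... | yes _    | no  _    = fromℕ< (DecRealizer.nonempty R (x , x∈X , x∈U′)) , s≤s z≤n

      W : Subset n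
      W = X ∩ ∁ (D ∩ U′)

      W? : Decidable W
      W? = X? ∩? ∁? (D? ∩? U′?)

      module Extended {c} (R : DecRealizer W c) where
        open Positions W? R

        rank : Vector (Fin n → ℕ) c
        rank i = maxBelow W? (position i)

        rank-monotone : AllOf (Monotone X) rank
        rank-monotone i _ _ = maxBelow-mono W? (position i)

        rank-reverses : Reverses W rank
        rank-reverses x∈W y∈W x⋠y = let i , lt = position-reverses x∈W y∈W x⋠y in
          i , subst₂ _<_ (sym (maxBelow-≡ W? (position-monotone i) y∈W))
                         (sym (maxBelow-≡ W? (position-monotone i) x∈W)) lt

      realizer-split : ∀ {a b c} → LinearExtension X →
                       DecRealizer (X ∩ D) a → DecRealizer (X ∩ U′) b → DecRealizer W c →
                       Realizer P X (a + b + c)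
      realizer-split {a} {b} {c} e R₁ R₂ R₃ =
        realizer-fromRanks e ((D₁.rank ++ U₂.rank) ++ W₃.rank)
          (++⁺ (Monotone X) (++⁺ (Monotone X) D₁.rank-monotone U₂.rank-monotone) W₃.rank-monotone)
          reverses nonempty
        where
        module D₁ = DownFirst R₁
        module U₂ = UpLast R₂
        module W₃ = Extended R₃

        reverses : Reverses X ((D₁.rank ++ U₂.rank) ++ W₃.rank)
        reverses {x} {y} x∈X y∈X x⋠y with D? y | U′? x
        ... | yes y∈D | _        =
          any-++⁺ˡ (Inverts x y) (any-++⁺ˡ (Inverts x y) (D₁.rank-reverse x∈X y∈X x⋠y y∈D))
        ... | no  _   | yes x∈U′ =
          any-++⁺ˡ (Inverts x y) (any-++⁺ʳ (Inverts x y) {xs = D₁.rank} (U₂.rank-reverse x∈X y∈X x⋠y x∈U′))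
        ... | no  y∉D | no  x∉U′ =
          any-++⁺ʳ (Inverts x y) (W₃.rank-reverses (x∈X , x∉U′ ∘ proj₂) (y∈X , y∉D ∘ proj₁) x⋠y)

        nonempty : Satisfiable X → 1 ≤ a + b + c
        nonempty (x , x∈X) with D? x
        ... | yes x∈D =
          ≤-trans (DecRealizer.nonempty R₁ (x , x∈X , x∈D)) (≤-trans (m≤m+n a b) (m≤m+n (a + b) c))
        ... | no  x∉D =
          ≤-trans (DecRealizer.nonempty R₃ (x , x∈X , x∉D ∘ proj₁)) (m≤n+m c (a + b))

    module _ {S : Subset n} (S? : Decidable S) where

      Down? : Decidable (Down P S)
      Down? x = any? λ s → S? s ×-dec ≼? x s

      Up? : Decidable (Up P S)
      Up? x = any? λ s → S? s ×-dec ≼? s x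

      S⊆Down∩Up : S ⊆ Down P S ∩ Up P S
      S⊆Down∩Up s∈S = (_ , s∈S , ≼-refl) , (_ , s∈S , ≼-refl)

      ∁[Down∩Up]⊆∁S : ∁ (Down P S ∩ Up P S) ⊆ ∁ S
      ∁[Down∩Up]⊆∁S = _∘ S⊆Down∩Up

      open Split Down? Up? (Down-isDownSet S) (Up-isUpSet S) using (realizer-split)

      realizer-all : ∀ {tP tY tC} → DecRealizer U tP → DecRealizer (Down P S ∪ Up P S) tY →
                     DecRealizer (∁ S) tC → Realizer P U (tY + tY + tC)
      realizer-all RP RY RC = realizer-split U? (linearExtension U? RP)
        (restrict (inj₁ ∘ proj₂) RY) (restrict (inj₂ ∘ proj₂) RY) (restrict (∁[Down∩Up]⊆∁S ∘ proj₂) RC)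

      realizer-comparable : ∀ {tP tD tU tW} → DecRealizer U tP → DecRealizer (Down P S) tD →
                            DecRealizer (Up P S) tU →
                            DecRealizer (_∖_ P (Down P S) S ∪ _∖_ P (Up P S) S) tW →
                            Realizer P (Down P S ∪ Up P S) (tD + tU + tW)
      realizer-comparable RP RD RU RW = realizer-split (Down? ∪? Up?)
        (linearExtension (Down? ∪? Up?) (restrict (λ _ → tt) RP))
        (restrict proj₂ RD) (restrict proj₂ RU) (restrict outside-S RW)
        where
        outside-S : (Down P S ∪ Up P S) ∩ ∁ (Down P S ∩ Up P S) ⊆ _∖_ P (Down P S) S ∪ _∖_ P (Up P S) S
        outside-S (inj₁ x∈D , x∉D∩U) = inj₁ (x∈D , ∁[Down∩Up]⊆∁S x∉D∩U)
        outside-S (inj₂ x∈U , x∉D∩U) = inj₂ (x∈U , ∁[Down∩Up]⊆∁S x∉D∩U)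

theorem1p8 : ∀ {n} (P : FinPoset n) (S : Subset n)
    (dP dDU dC dD dU dDU' : ℕ)
    → IsDim P U dP
    → IsDim P (Down P S ∪ Up P S) dDU
    → IsDim P (∁ S) dC
    → IsDim P (Down P S) dD
    → IsDim P (Up P S) dU
    → IsDim P (_∖_ P (Down P S) S ∪ _∖_ P (Up P S) S) dDU'
    → (dP ≤ 2 * (dDU + dC)) × (dDU ≤ dD + dU + dDU')
theorem1p8 P S dP dDU dC dD dU dDU' (RP , minP) (RY , minY) (RC , _) (RD , _) (RU , _) (RW , _) =
  decidable-stable ((dP ≤? 2 * (dDU + dC)) ×-dec (dDU ≤? dD + dU + dDU')) do
    ≼? ← ¬¬-decidable₂ (FinPoset._≼_ P)
    S? ← ¬¬-decidable S
    LP? ← ¬¬-decidableRealizer RP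
    LY? ← ¬¬-decidableRealizer RY
    LC? ← ¬¬-decidableRealizer RC
    LD? ← ¬¬-decidableRealizer RD
    LU? ← ¬¬-decidableRealizer RU
    LW? ← ¬¬-decidableRealizer RW
    let RP′ = RP with-decidable LP?
    pure ( ≤-trans (minP _ (realizer-all P ≼? S? RP′ (RY with-decidable LY?) (RC with-decidable LC?)))
                   (m+m+n≤2*[m+n] dDU dC)
         , minY _ (realizer-comparable P ≼? S? RP′ (RD with-decidable LD?) (RU with-decidable LU?)
                                              (RW with-decidable LW?)) )
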